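{- The following three statements are equivalent. (1) (Semantic Diagonal Lemma) For every formula $\Psi(x)$ of the language of arithmetic with exactly one free variable $x$, there exists a sentence $\theta$ such that $\mathbb{N}\vDash\Psi(\ulcorner\theta\urcorner)\leftrightarrow\theta$. (2) (Semantic Gödel Incompleteness Theorem) For every definable and sound theory $T$ there exists a sentence which is true in $\mathbb{N}$ and independent from $T$ (i.e. $T\nvdash\gamma$ and $T\nvdash\neg\gamma$). (3) (Semantic Tarski Undefinability Theorem) The set $\{\ulcorner\eta\urcorner\mid \eta \text{ is a sentence and } \mathbb{N}\vDash\eta\}$ of Gödel codes of true sentences is not definable in $\mathbb{N}$.
   Context: We work in the first-order language of arithmetic, with standard model $\mathbb{N}$. A fixed (suitable) Gödel coding assigns to each syntactic object $\alpha$ a number, and $\ulcorner\alpha\urcorner$ denotes the closed term (numeral) representing that number. A set $A\subseteq\mathbb{N}$ is definable in $\mathbb{N}$ if there is a formula $\Gamma(x)$ with $n\in A\iff\mathbb{N}\vDash\Gamma(\overline{n})$ for all $n$. A theory $T$ (in the language of arithmetic) is definable if there is a formula ${\sf Pr}_T(x)$ such that for every sentence $\eta$, $T\vdash\eta$ iff $\mathbb{N}\vDash{\sf Pr}_T(\ulcorner\eta\urcorner)$; $T$ is sound if every sentence provable in $T$ is true in $\mathbb{N}$. -}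

module Defs where

open import Data.Nat using (ℕ; zero; suc; _+_; _*_)
open import Data.Fin using (Fin; zero; suc)
open import Data.List using (List; []; _∷_; map)
open import Data.List.Membership.Propositional using (_∈_)
open import Data.Product using (Σ; _×_; _,_)
open import Data.Sum using (_⊎_)
open import Data.Empty using (⊥)
open import Relation.Nullary using (¬_)
open import Relation.Binary.PropositionalEquality using (_≡_)
open import Function.Bundles using (_⇔_)
open import Function.Definitions using (Injective)

-- Syntax of first-order arithmetic (language 0, S, +, ·, =),
-- de Bruijn indices; Tm n / Fm n have (at most) n free variables.

data Tm (n : ℕ) : Set where
  var   : Fin n → Tm n
  `0    : Tm n
  `S    : Tm n → Tm n
  _`+_  : Tm n → Tm n → Tm n
  _`*_  : Tm n → Tm n → Tm n

infix  7 _≐_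
infixr 5 _⇒_
infixr 6 _∧̇_ _∨̇_

data Fm (n : ℕ) : Set where
  _≐_  : Tm n → Tm n → Fm n
  ⊥̇    : Fm n
  _⇒_  : Fm n → Fm n → Fm n
  _∧̇_  : Fm n → Fm n → Fm n
  _∨̇_  : Fm n → Fm n → Fm n
  ∀̇    : Fm (suc n) → Fm n
  ∃̇    : Fm (suc n) → Fm n

Sentence : Set
Sentence = Fm 0

¬̇_ : ∀ {n} → Fm n → Fm n
¬̇ φ = φ ⇒ ⊥̇

_⇔̇_ : ∀ {n} → Fm n → Fm n → Fm n
φ ⇔̇ ψ = (φ ⇒ ψ) ∧̇ (ψ ⇒ φ)

num : ∀ {n} → ℕ → Tm n
num zero    = `0
num (suc k) = `S (num k)

ext : ∀ {m n} → (Fin m → Fin n) → Fin (suc m) → Fin (suc n)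
ext ρ zero    = zero
ext ρ (suc i) = suc (ρ i)

renT : ∀ {m n} → (Fin m → Fin n) → Tm m → Tm n
renT ρ (var i)   = var (ρ i)
renT ρ `0        = `0
renT ρ (`S t)    = `S (renT ρ t)
renT ρ (t `+ u)  = renT ρ t `+ renT ρ u
renT ρ (t `* u)  = renT ρ t `* renT ρ u

renF : ∀ {m n} → (Fin m → Fin n) → Fm m → Fm n
renF ρ (t ≐ u)  = renT ρ t ≐ renT ρ u
renF ρ ⊥̇        = ⊥̇
renF ρ (φ ⇒ ψ)  = renF ρ φ ⇒ renF ρ ψ
renF ρ (φ ∧̇ ψ)  = renF ρ φ ∧̇ renF ρ ψ
renF ρ (φ ∨̇ ψ)  = renF ρ φ ∨̇ renF ρ ψ
renF ρ (∀̇ φ)    = ∀̇ (renF (ext ρ) φ)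
renF ρ (∃̇ φ)    = ∃̇ (renF (ext ρ) φ)

exts : ∀ {m n} → (Fin m → Tm n) → Fin (suc m) → Tm (suc n)
exts σ zero    = var zero
exts σ (suc i) = renT suc (σ i)

subT : ∀ {m n} → (Fin m → Tm n) → Tm m → Tm n
subT σ (var i)   = σ i
subT σ `0        = `0
subT σ (`S t)    = `S (subT σ t)
subT σ (t `+ u)  = subT σ t `+ subT σ u
subT σ (t `* u)  = subT σ t `* subT σ u

subF : ∀ {m n} → (Fin m → Tm n) → Fm m → Fm n
subF σ (t ≐ u)  = subT σ t ≐ subT σ u
subF σ ⊥̇        = ⊥̇
subF σ (φ ⇒ ψ)  = subF σ φ ⇒ subF σ ψ
subF σ (φ ∧̇ ψ)  = subF σ φ ∧̇ subF σ ψ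
subF σ (φ ∨̇ ψ)  = subF σ φ ∨̇ subF σ ψ
subF σ (∀̇ φ)    = ∀̇ (subF (exts σ) φ)
subF σ (∃̇ φ)    = ∃̇ (subF (exts σ) φ)

-- φ[t/x₀] : substitute t for the variable 0 (remaining variables shift down)
sub0σ : ∀ {n} → Tm n → Fin (suc n) → Tm n
sub0σ t zero    = t
sub0σ t (suc i) = var i

_[_] : ∀ {n} → Fm (suc n) → Tm n → Fm n
φ [ t ] = subF (sub0σ t) φ

wkF : ∀ {n} → Fm n → Fm (suc n)
wkF = renF suc

closeF : ∀ {n} → Sentence → Fm n
closeF = renF (λ ())

cons : ∀ {n} → ℕ → (Fin n → ℕ) → Fin (suc n) → ℕ
cons a e zero    = a
cons a e (suc i) = e i

evalT : ∀ {n} → (Fin n → ℕ) → Tm n → ℕ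
evalT e (var i)   = e i
evalT e `0        = 0
evalT e (`S t)    = suc (evalT e t)
evalT e (t `+ u)  = evalT e t + evalT e u
evalT e (t `* u)  = evalT e t * evalT e u

Sat : ∀ {n} → (Fin n → ℕ) → Fm n → Set
Sat e (t ≐ u)  = evalT e t ≡ evalT e u
Sat e ⊥̇        = ⊥
Sat e (φ ⇒ ψ)  = Sat e φ → Sat e ψ
Sat e (φ ∧̇ ψ)  = Sat e φ × Sat e ψ
Sat e (φ ∨̇ ψ)  = Sat e φ ⊎ Sat e ψ
Sat e (∀̇ φ)    = (a : ℕ) → Sat (cons a e) φ
Sat e (∃̇ φ)    = Σ ℕ λ a → Sat (cons a e) φ

ℕ⊨_ : Sentence → Set
ℕ⊨ η = Sat (λ ()) η

Theory : Set₁
Theory = Sentence → Set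

data Deriv (T : Theory) : {n : ℕ} → List (Fm n) → Fm n → Set where
  axm   : ∀ {n} {Γ : List (Fm n)} {ψ} → T ψ → Deriv T Γ (closeF ψ)
  hyp   : ∀ {n} {Γ : List (Fm n)} {φ} → φ ∈ Γ → Deriv T Γ φ
  ⇒I    : ∀ {n} {Γ : List (Fm n)} {φ ψ} → Deriv T (φ ∷ Γ) ψ → Deriv T Γ (φ ⇒ ψ)
  ⇒E    : ∀ {n} {Γ : List (Fm n)} {φ ψ} → Deriv T Γ (φ ⇒ ψ) → Deriv T Γ φ → Deriv T Γ ψ
  ∧I    : ∀ {n} {Γ : List (Fm n)} {φ ψ} → Deriv T Γ φ → Deriv T Γ ψ → Deriv T Γ (φ ∧̇ ψ)
  ∧E₁   : ∀ {n} {Γ : List (Fm n)} {φ ψ} → Deriv T Γ (φ ∧̇ ψ) → Deriv T Γ φ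
  ∧E₂   : ∀ {n} {Γ : List (Fm n)} {φ ψ} → Deriv T Γ (φ ∧̇ ψ) → Deriv T Γ ψ
  ∨I₁   : ∀ {n} {Γ : List (Fm n)} {φ ψ} → Deriv T Γ φ → Deriv T Γ (φ ∨̇ ψ)
  ∨I₂   : ∀ {n} {Γ : List (Fm n)} {φ ψ} → Deriv T Γ ψ → Deriv T Γ (φ ∨̇ ψ)
  ∨E    : ∀ {n} {Γ : List (Fm n)} {φ ψ χ} → Deriv T Γ (φ ∨̇ ψ) →
          Deriv T (φ ∷ Γ) χ → Deriv T (ψ ∷ Γ) χ → Deriv T Γ χ
  raa   : ∀ {n} {Γ : List (Fm n)} {φ} → Deriv T ((¬̇ φ) ∷ Γ) ⊥̇ → Deriv T Γ φ
  ∀I    : ∀ {n} {Γ : List (Fm n)} {φ} → Deriv T (map wkF Γ) φ → Deriv T Γ (∀̇ φ)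
  ∀E    : ∀ {n} {Γ : List (Fm n)} {φ} → Deriv T Γ (∀̇ φ) → (t : Tm n) → Deriv T Γ (φ [ t ])
  ∃I    : ∀ {n} {Γ : List (Fm n)} {φ} (t : Tm n) → Deriv T Γ (φ [ t ]) → Deriv T Γ (∃̇ φ)
  ∃E    : ∀ {n} {Γ : List (Fm n)} {φ ψ} → Deriv T Γ (∃̇ φ) →
          Deriv T (φ ∷ map wkF Γ) (wkF ψ) → Deriv T Γ ψ
  ≐refl : ∀ {n} {Γ : List (Fm n)} (t : Tm n) → Deriv T Γ (t ≐ t)
  ≐subst : ∀ {n} {Γ : List (Fm n)} (φ : Fm (suc n)) {t u : Tm n} →
          Deriv T Γ (t ≐ u) → Deriv T Γ (φ [ t ]) → Deriv T Γ (φ [ u ])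

_⊢_ : Theory → Sentence → Set
T ⊢ η = Deriv T [] η

-- The paper fixes a "suitable" coding; the only property of
-- it used here (besides injectivity) is that the set of codes of
-- sentences is definable in ℕ.  We therefore quantify over all codings
-- with these properties.

Definable : (ℕ → Set) → Set
Definable A = Σ (Fm 1) λ Γ → (n : ℕ) → A n ⇔ (ℕ⊨ (Γ [ num n ]))

record GödelCoding : Set₁ where
  field
    code           : Sentence → ℕ
    code-injective : Injective _≡_ _≡_ code
    sentences-definable : Definable (λ n → Σ Sentence λ η → code η ≡ n)

module _ (G : GödelCoding) where
  open GödelCoding G

  ⌜_⌝ : ∀ {n} → Sentence → Tm n
  ⌜ η ⌝ = num (code η)

  DefinableTheory : Theory → Set
  DefinableTheory T = Σ (Fm 1) λ Pr → (η : Sentence) → (T ⊢ η) ⇔ (ℕ⊨ (Pr [ ⌜ η ⌝ ]))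

  SoundTheory : Theory → Set
  SoundTheory T = (η : Sentence) → T ⊢ η → ℕ⊨ η

  SemanticDiagonalLemma : Set
  SemanticDiagonalLemma =
    (Ψ : Fm 1) → Σ Sentence λ θ → ℕ⊨ ((Ψ [ ⌜ θ ⌝ ]) ⇔̇ θ)

  SemanticIncompleteness : Set₁
  SemanticIncompleteness =
    (T : Theory) → DefinableTheory T → SoundTheory T →
    Σ Sentence λ γ → ℕ⊨ γ × ¬ (T ⊢ γ) × ¬ (T ⊢ (¬̇ γ))

  TrueCodes : ℕ → Set
  TrueCodes n = Σ Sentence λ η → (code η ≡ n) × ℕ⊨ η

  SemanticTarski : Set
  SemanticTarski = ¬ Definable TrueCodes

LEM : Set₁
LEM = (P : Set) → P ⊎ ¬ P

-- Call χ : Fm 1 a truth definition if ℕ ⊨ η ↔ ℕ ⊨ χ(⌜η⌝) for every sentence η.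
-- Since the coding is injective and the codes of sentences form a definable set,
-- truth definitions exist exactly when the set of codes of true sentences is
-- definable, and each of the three statements amounts to their non-existence.
-- A fixed point of ¬χ is a liar sentence for a truth definition χ; conversely,
-- if Ψ has no fixed point then ¬Ψ is a truth definition, and if a sound
-- definable theory decides every true sentence then its provability predicate
-- is one. Finally, the theory of all true sentences is sound and is definable
-- by any truth definition, yet it proves each of its true sentences outright.
-- Classical logic in the metatheory (LEM) is needed for the soundness of
-- reductio ad absurdum and for the converse directions.

module Submission where

open import Defs
open import Data.Nat using (ℕ; suc; _+_; _*_)
open import Data.Fin using (Fin; zero; suc)
open import Data.List using (List; map)
open import Data.List.Relation.Unary.All as All using (All; []; _∷_)
open import Data.List.Relation.Unary.All.Properties using (map⁺)
open import Data.Product using (Σ; _×_; _,_; proj₁; proj₂)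
open import Data.Product.Function.NonDependent.Propositional using (_×-⇔_)
open import Data.Product.Function.Dependent.Propositional using (congˡ)
open import Data.Sum using (inj₁; inj₂; [_,_])
open import Data.Sum.Function.Propositional using (_⊎-⇔_)
open import Data.Empty using (⊥-elim)
open import Function using (_∘_; const)
open import Function.Bundles using (_⇔_; mk⇔; Equivalence)
open import Function.Construct.Composition using (_⇔-∘_)
open import Function.Construct.Identity using (⇔-id)
open import Function.Related.Propositional using (equivalence)
open import Function.Related.TypeIsomorphisms using (→-cong-⇔)
open import Relation.Nullary using (¬_)
open import Relation.Binary.PropositionalEquality
  using (_≡_; _≗_; refl; sym; trans; cong; cong₂; subst)

open Equivalence using (to; from)

∀-cong-⇔ : {A : Set} {P Q : A → Set} → (∀ a → P a ⇔ Q a) → ((a : A) → P a) ⇔ ((a : A) → Q a)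
∀-cong-⇔ P⇔Q = mk⇔ (λ f a → to (P⇔Q a) (f a)) (λ g a → from (P⇔Q a) (g a))

∃-cong-⇔ : {A : Set} {P Q : A → Set} → (∀ a → P a ⇔ Q a) → Σ A P ⇔ Σ A Q
∃-cong-⇔ P⇔Q = congˡ {k = equivalence} (P⇔Q _)

≡-cong-⇔ : {a b c d : ℕ} → a ≡ c → b ≡ d → (a ≡ b) ⇔ (c ≡ d)
≡-cong-⇔ refl refl = ⇔-id _

ext-cons : ∀ {m n} {ρ : Fin m → Fin n} {e : Fin n → ℕ} {e'} a →
           e ∘ ρ ≗ e' → cons a e ∘ ext ρ ≗ cons a e'
ext-cons a h zero    = refl
ext-cons a h (suc i) = h i

evalT-renT : ∀ {m n} {ρ : Fin m → Fin n} {e : Fin n → ℕ} {e'} →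
             e ∘ ρ ≗ e' → ∀ t → evalT e (renT ρ t) ≡ evalT e' t
evalT-renT h (var i)  = h i
evalT-renT h `0       = refl
evalT-renT h (`S t)   = cong suc (evalT-renT h t)
evalT-renT h (t `+ u) = cong₂ _+_ (evalT-renT h t) (evalT-renT h u)
evalT-renT h (t `* u) = cong₂ _*_ (evalT-renT h t) (evalT-renT h u)

Sat-renF : ∀ {m n} {ρ : Fin m → Fin n} {e : Fin n → ℕ} {e'} →
           e ∘ ρ ≗ e' → ∀ φ → Sat e (renF ρ φ) ⇔ Sat e' φ
Sat-renF h (t ≐ u) = ≡-cong-⇔ (evalT-renT h t) (evalT-renT h u)
Sat-renF h ⊥̇       = ⇔-id _
Sat-renF h (φ ⇒ ψ) = →-cong-⇔ (Sat-renF h φ) (Sat-renF h ψ)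
Sat-renF h (φ ∧̇ ψ) = Sat-renF h φ ×-⇔ Sat-renF h ψ
Sat-renF h (φ ∨̇ ψ) = Sat-renF h φ ⊎-⇔ Sat-renF h ψ
Sat-renF h (∀̇ φ)   = ∀-cong-⇔ λ a → Sat-renF (ext-cons a h) φ
Sat-renF h (∃̇ φ)   = ∃-cong-⇔ λ a → Sat-renF (ext-cons a h) φ

Sat-wkF : ∀ {n} {e : Fin n → ℕ} a φ → Sat (cons a e) (wkF φ) ⇔ Sat e φ
Sat-wkF a = Sat-renF λ _ → refl

exts-cons : ∀ {m n} {σ : Fin m → Tm n} {e : Fin n → ℕ} {e'} a →
            evalT e ∘ σ ≗ e' → evalT (cons a e) ∘ exts σ ≗ cons a e'
exts-cons a h zero    = refl
exts-cons {σ = σ} a h (suc i) = trans (evalT-renT (λ _ → refl) (σ i)) (h i)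

evalT-subT : ∀ {m n} {σ : Fin m → Tm n} {e : Fin n → ℕ} {e'} →
             evalT e ∘ σ ≗ e' → ∀ t → evalT e (subT σ t) ≡ evalT e' t
evalT-subT h (var i)  = h i
evalT-subT h `0       = refl
evalT-subT h (`S t)   = cong suc (evalT-subT h t)
evalT-subT h (t `+ u) = cong₂ _+_ (evalT-subT h t) (evalT-subT h u)
evalT-subT h (t `* u) = cong₂ _*_ (evalT-subT h t) (evalT-subT h u)

Sat-subF : ∀ {m n} {σ : Fin m → Tm n} {e : Fin n → ℕ} {e'} →
           evalT e ∘ σ ≗ e' → ∀ φ → Sat e (subF σ φ) ⇔ Sat e' φ
Sat-subF h (t ≐ u) = ≡-cong-⇔ (evalT-subT h t) (evalT-subT h u)
Sat-subF h ⊥̇       = ⇔-id _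
Sat-subF h (φ ⇒ ψ) = →-cong-⇔ (Sat-subF h φ) (Sat-subF h ψ)
Sat-subF h (φ ∧̇ ψ) = Sat-subF h φ ×-⇔ Sat-subF h ψ
Sat-subF h (φ ∨̇ ψ) = Sat-subF h φ ⊎-⇔ Sat-subF h ψ
Sat-subF h (∀̇ φ)   = ∀-cong-⇔ λ a → Sat-subF (exts-cons a h) φ
Sat-subF h (∃̇ φ)   = ∃-cong-⇔ λ a → Sat-subF (exts-cons a h) φ

Sat-[] : ∀ {n} {e : Fin n → ℕ} {a} φ t → evalT e t ≡ a → Sat e (φ [ t ]) ⇔ Sat (cons a e) φ
Sat-[] {e = e} {a} φ t t≡a = Sat-subF sub0-cons φ
  where
  sub0-cons : evalT e ∘ sub0σ t ≗ cons a e
  sub0-cons zero    = t≡a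
  sub0-cons (suc i) = refl

All-wkF : ∀ {n} {e : Fin n → ℕ} {Γ} a → All (Sat e) Γ → All (Sat (cons a e)) (map wkF Γ)
All-wkF a H = map⁺ (All.map (λ {ψ} → from (Sat-wkF a ψ)) H)

module _ (lem : LEM) {T : Theory} (axioms-true : ∀ η → T η → ℕ⊨ η) where

  Deriv-sound : ∀ {n} {Γ : List (Fm n)} {φ} → Deriv T Γ φ → ∀ e → All (Sat e) Γ → Sat e φ
  Deriv-sound (axm {ψ = ψ} p)   e H = from (Sat-renF (λ ()) ψ) (axioms-true ψ p)
  Deriv-sound (hyp φ∈Γ)         e H = All.lookup H φ∈Γ
  Deriv-sound (⇒I d)            e H = λ x → Deriv-sound d e (x ∷ H)
  Deriv-sound (⇒E d d₁)         e H = Deriv-sound d e H (Deriv-sound d₁ e H)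
  Deriv-sound (∧I d d₁)         e H = Deriv-sound d e H , Deriv-sound d₁ e H
  Deriv-sound (∧E₁ d)           e H = proj₁ (Deriv-sound d e H)
  Deriv-sound (∧E₂ d)           e H = proj₂ (Deriv-sound d e H)
  Deriv-sound (∨I₁ d)           e H = inj₁ (Deriv-sound d e H)
  Deriv-sound (∨I₂ d)           e H = inj₂ (Deriv-sound d e H)
  Deriv-sound (∨E d d₁ d₂)      e H =
    [ (λ x → Deriv-sound d₁ e (x ∷ H)) , (λ y → Deriv-sound d₂ e (y ∷ H)) ] (Deriv-sound d e H)
  Deriv-sound (raa {φ = φ} d)   e H with lem (Sat e φ)
  ... | inj₁ x  = x
  ... | inj₂ ¬x = ⊥-elim (Deriv-sound d e (¬x ∷ H))
  Deriv-sound (∀I d)            e H = λ a → Deriv-sound d (cons a e) (All-wkF a H)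
  Deriv-sound (∀E {φ = φ} d t)  e H = from (Sat-[] φ t refl) (Deriv-sound d e H (evalT e t))
  Deriv-sound (∃I {φ = φ} t d)  e H = evalT e t , to (Sat-[] φ t refl) (Deriv-sound d e H)
  Deriv-sound (∃E {ψ = ψ} d d₁) e H with Deriv-sound d e H
  ... | a , s = to (Sat-wkF a ψ) (Deriv-sound d₁ (cons a e) (s ∷ All-wkF a H))
  Deriv-sound (≐refl t)         e H = refl
  Deriv-sound (≐subst φ {t} {u} d d₁) e H =
    from (Sat-[] φ u (sym (Deriv-sound d e H))) (to (Sat-[] φ t refl) (Deriv-sound d₁ e H))

  sound : ∀ {η} → T ⊢ η → ℕ⊨ η
  sound d = Deriv-sound d (λ ()) []

renT-id : ∀ {n} {ρ : Fin n → Fin n} → (∀ i → ρ i ≡ i) → ∀ t → renT ρ t ≡ t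
renT-id h (var i)  = cong var (h i)
renT-id h `0       = refl
renT-id h (`S t)   = cong `S (renT-id h t)
renT-id h (t `+ u) = cong₂ _`+_ (renT-id h t) (renT-id h u)
renT-id h (t `* u) = cong₂ _`*_ (renT-id h t) (renT-id h u)

ext-id : ∀ {n} {ρ : Fin n → Fin n} → (∀ i → ρ i ≡ i) → ∀ i → ext ρ i ≡ i
ext-id h zero    = refl
ext-id h (suc i) = cong suc (h i)

renF-id : ∀ {n} {ρ : Fin n → Fin n} → (∀ i → ρ i ≡ i) → ∀ φ → renF ρ φ ≡ φ
renF-id h (t ≐ u) = cong₂ _≐_ (renT-id h t) (renT-id h u)
renF-id h ⊥̇       = refl
renF-id h (φ ⇒ ψ) = cong₂ _⇒_ (renF-id h φ) (renF-id h ψ)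
renF-id h (φ ∧̇ ψ) = cong₂ _∧̇_ (renF-id h φ) (renF-id h ψ)
renF-id h (φ ∨̇ ψ) = cong₂ _∨̇_ (renF-id h φ) (renF-id h ψ)
renF-id h (∀̇ φ)   = cong ∀̇ (renF-id (ext-id h) φ)
renF-id h (∃̇ φ)   = cong ∃̇ (renF-id (ext-id h) φ)

axiom : ∀ {T : Theory} {η} → T η → T ⊢ η
axiom {T} {η} p = subst (T ⊢_) (renF-id (λ ()) η) (axm p)

Thℕ : Theory
Thℕ = ℕ⊨_

Thℕ-⊢⇔⊨ : LEM → ∀ {η} → Thℕ ⊢ η ⇔ ℕ⊨ η
Thℕ-⊢⇔⊨ lem = mk⇔ (sound lem λ _ ⊨η → ⊨η) axiom

module _ (G : GödelCoding) where
  open GödelCoding G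

  TruthDefinition : Fm 1 → Set
  TruthDefinition χ = (η : Sentence) → ℕ⊨ η ⇔ ℕ⊨ (χ [ num (code η) ])

  -- χ alone may hold at numbers coding no sentence; conjoining isSentence excludes them.
  truthDefinition⇒definable : ∀ χ → TruthDefinition χ → Definable (TrueCodes G)
  truthDefinition⇒definable χ χ-true = isSentence ∧̇ χ , λ n → mk⇔ (forward n) (backward n)
    where
    isSentence : Fm 1
    isSentence = proj₁ sentences-definable

    isSentence-def : ∀ n → (Σ Sentence λ η → code η ≡ n) ⇔ ℕ⊨ (isSentence [ num n ])
    isSentence-def = proj₂ sentences-definable

    forward : ∀ n → TrueCodes G n → ℕ⊨ ((isSentence ∧̇ χ) [ num n ])
    forward n (η , refl , ⊨η) = to (isSentence-def n) (η , refl) , to (χ-true η) ⊨η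

    backward : ∀ n → ℕ⊨ ((isSentence ∧̇ χ) [ num n ]) → TrueCodes G n
    backward n (isCode , ⊨χ) with from (isSentence-def n) isCode
    ... | η , refl = η , refl , from (χ-true η) ⊨χ

  definesTrueCodes⇒truthDefinition : ∀ {χ} → (∀ n → TrueCodes G n ⇔ ℕ⊨ (χ [ num n ])) →
                                     TruthDefinition χ
  definesTrueCodes⇒truthDefinition {χ} χ-def η =
    mk⇔ (λ ⊨η → to (χ-def _) (η , refl , ⊨η)) backward
    where
    backward : ℕ⊨ (χ [ num (code η) ]) → ℕ⊨ η
    backward ⊨χ with from (χ-def _) ⊨χ
    ... | η′ , code-eq , ⊨η′ = subst ℕ⊨_ (code-injective code-eq) ⊨η′

  diagonal⇒noTruthDefinition : SemanticDiagonalLemma G → ∀ χ → ¬ TruthDefinition χ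
  diagonal⇒noTruthDefinition diag χ χ-true with diag (¬̇ χ)
  ... | θ , ¬χ⇒θ , θ⇒¬χ = ⊭θ (¬χ⇒θ (⊭θ ∘ from (χ-true θ)))
    where
    ⊭θ : ¬ ℕ⊨ θ
    ⊭θ ⊨θ = θ⇒¬χ ⊨θ (to (χ-true θ) ⊨θ)

  diagonal⇒tarski : SemanticDiagonalLemma G → SemanticTarski G
  diagonal⇒tarski diag (χ , χ-def) =
    diagonal⇒noTruthDefinition diag χ (definesTrueCodes⇒truthDefinition χ-def)

  Thℕ-definable : LEM → Definable (TrueCodes G) → DefinableTheory G Thℕ
  Thℕ-definable lem (χ , χ-def) =
    χ , λ η → definesTrueCodes⇒truthDefinition χ-def η ⇔-∘ Thℕ-⊢⇔⊨ lem

  incompleteness⇒tarski : LEM → SemanticIncompleteness G → SemanticTarski G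
  incompleteness⇒tarski lem incomplete truth-definable
    with incomplete Thℕ (Thℕ-definable lem truth-definable) (λ _ → to (Thℕ-⊢⇔⊨ lem))
  ... | γ , ⊨γ , ⊬γ , _ = ⊬γ (axiom ⊨γ)

  tarski⇒diagonal : LEM → SemanticTarski G → SemanticDiagonalLemma G
  tarski⇒diagonal lem tarski Ψ with lem (Σ Sentence λ θ → ℕ⊨ ((Ψ [ num (code θ) ]) ⇔̇ θ))
  ... | inj₁ fixedPoint = fixedPoint
  ... | inj₂ noFixedPoint = ⊥-elim (tarski (truthDefinition⇒definable (¬̇ Ψ) ¬Ψ-true))
    where
    ¬Ψ-true : TruthDefinition (¬̇ Ψ)
    ¬Ψ-true η = mk⇔ (λ ⊨η ⊨Ψ → noFixedPoint (η , const ⊨η , const ⊨Ψ)) backward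
      where
      backward : ¬ ℕ⊨ (Ψ [ num (code η) ]) → ℕ⊨ η
      backward ⊭Ψ with lem (ℕ⊨ η)
      ... | inj₁ ⊨η = ⊨η
      ... | inj₂ ⊭η = ⊥-elim (noFixedPoint (η , ⊥-elim ∘ ⊭Ψ , ⊥-elim ∘ ⊭η))

  tarski⇒incompleteness : LEM → SemanticTarski G → SemanticIncompleteness G
  tarski⇒incompleteness lem tarski T (Pr , Pr-def) T-sound
    with lem (Σ Sentence λ γ → ℕ⊨ γ × ¬ (T ⊢ γ) × ¬ (T ⊢ (¬̇ γ)))
  ... | inj₁ independent = independent
  ... | inj₂ noIndependent =
    ⊥-elim (tarski (truthDefinition⇒definable Pr λ η → Pr-def η ⇔-∘ mk⇔ (true⇒provable η) (T-sound η)))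
    where
    true⇒provable : ∀ γ → ℕ⊨ γ → T ⊢ γ
    true⇒provable γ ⊨γ with lem (T ⊢ γ) | lem (T ⊢ (¬̇ γ))
    ... | inj₁ ⊢γ | _        = ⊢γ
    ... | inj₂ ⊬γ | inj₁ ⊢¬γ = ⊥-elim (T-sound (¬̇ γ) ⊢¬γ ⊨γ)
    ... | inj₂ ⊬γ | inj₂ ⊬¬γ = ⊥-elim (noIndependent (γ , ⊨γ , ⊬γ , ⊬¬γ))

theorem2p4 : LEM → (G : GödelCoding) →
    (SemanticDiagonalLemma G ⇔ SemanticIncompleteness G) ×
    (SemanticIncompleteness G ⇔ SemanticTarski G)
theorem2p4 lem G =
  mk⇔ (tarski⇒incompleteness G lem ∘ diagonal⇒tarski G)
      (tarski⇒diagonal G lem ∘ incompleteness⇒tarski G lem) ,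
  mk⇔ (incompleteness⇒tarski G lem) (tarski⇒incompleteness G lem)
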